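{- Let $\mathbb{T}$ be a monad on a category $\mathbf{C}$ with finite coproducts and let $X\#Y=T(X+Y)$ be the associated parametrized monad. Then the category $\mathbf{C}^{\mathbb{T}}$ of Eilenberg–Moore $\mathbb{T}$-algebras is isomorphic to the full subcategory of the category of $\#$-algebras consisting of those $\#$-algebras $a:T(A+A)\to A$ which factor through $T\nabla:T(A+A)\to TA$, where $\nabla=[\mathrm{id},\mathrm{id}]$.
   Context: Monads are Kleisli triples $(T,\eta,(-)^*)$, $\mu=\mathrm{id}^*$. The parametrized monad $X\#Y=T(X+Y)$ has unit $u^Y_X=\eta\circ\mathsf{inl}:X\to T(X+Y)$ and multiplication $m^Y_X=[\mathrm{id},\eta\circ\mathsf{inr}]^*:T(T(X+Y)+Y)\to T(X+Y)$. A $\#$-algebra is $(A,a)$, $a:A\#A\to A$, with $a\circ u^A_A=\mathrm{id}$ and $a\circ(a\#\mathrm{id})=a\circ m^A_A$; a morphism of $\#$-algebras $(A,a)\to(B,b)$ is $f:A\to B$ with $f\circ a=b\circ(f\# f)$. Morphisms of $\mathbf{C}^{\mathbb{T}}$ are the usual $\mathbb{T}$-algebra homomorphisms. -}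

module Defs where

open import Level using (Level; _⊔_; suc)
open import Data.Product using (Σ; ∃; _×_; _,_; proj₁; proj₂)
open import Relation.Binary using (Rel; IsEquivalence; Setoid)
import Relation.Binary.Reasoning.Setoid as SetoidR
open import Relation.Binary.PropositionalEquality using (_≡_; refl; cong)

record Category (o ℓ e : Level) : Set (suc (o ⊔ ℓ ⊔ e)) where
  infixr 9 _∘_
  infix  4 _≈_
  field
    Obj   : Set o
    Hom   : Obj → Obj → Set ℓ
    _≈_   : ∀ {A B} → Rel (Hom A B) e
    id    : ∀ {A} → Hom A A
    _∘_   : ∀ {A B C} → Hom B C → Hom A B → Hom A C
    equiv     : ∀ {A B} → IsEquivalence (_≈_ {A} {B})
    ∘-resp-≈  : ∀ {A B C} {f h : Hom B C} {g i : Hom A B} →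
                f ≈ h → g ≈ i → f ∘ g ≈ h ∘ i
    identityˡ : ∀ {A B} {f : Hom A B} → id ∘ f ≈ f
    identityʳ : ∀ {A B} {f : Hom A B} → f ∘ id ≈ f
    assoc     : ∀ {A B C D} {f : Hom A B} {g : Hom B C} {h : Hom C D} →
                (h ∘ g) ∘ f ≈ h ∘ (g ∘ f)

record Functor {o ℓ e o′ ℓ′ e′ : Level}
               (𝒞 : Category o ℓ e) (𝒟 : Category o′ ℓ′ e′)
               : Set (o ⊔ ℓ ⊔ e ⊔ o′ ⊔ ℓ′ ⊔ e′) where
  private
    module C = Category 𝒞
    module D = Category 𝒟
  field
    F₀ : C.Obj → D.Obj
    F₁ : ∀ {A B} → C.Hom A B → D.Hom (F₀ A) (F₀ B)
    identity     : ∀ {A} → F₁ (C.id {A}) D.≈ D.id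
    homomorphism : ∀ {A B C} {f : C.Hom A B} {g : C.Hom B C} →
                   F₁ (g C.∘ f) D.≈ F₁ g D.∘ F₁ f
    F-resp-≈     : ∀ {A B} {f g : C.Hom A B} → f C.≈ g → F₁ f D.≈ F₁ g

record Initial {o ℓ e} (𝒞 : Category o ℓ e) : Set (o ⊔ ℓ ⊔ e) where
  open Category 𝒞
  field
    ⊥       : Obj
    ¡       : ∀ {A} → Hom ⊥ A
    ¡-unique : ∀ {A} (f : Hom ⊥ A) → ¡ ≈ f

record BinaryCoproducts {o ℓ e} (𝒞 : Category o ℓ e) : Set (o ⊔ ℓ ⊔ e) where
  open Category 𝒞
  infixr 6 _+_
  field
    _+_   : Obj → Obj → Obj
    inl   : ∀ {A B} → Hom A (A + B)
    inr   : ∀ {A B} → Hom B (A + B)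
    [_,_] : ∀ {A B C} → Hom A C → Hom B C → Hom (A + B) C
    inject₁ : ∀ {A B C} {f : Hom A C} {g : Hom B C} → [ f , g ] ∘ inl ≈ f
    inject₂ : ∀ {A B C} {f : Hom A C} {g : Hom B C} → [ f , g ] ∘ inr ≈ g
    unique  : ∀ {A B C} {h : Hom (A + B) C} {f : Hom A C} {g : Hom B C} →
              h ∘ inl ≈ f → h ∘ inr ≈ g → [ f , g ] ≈ h

record KleisliTriple {o ℓ e} (𝒞 : Category o ℓ e) : Set (o ⊔ ℓ ⊔ e) where
  open Category 𝒞
  field
    T   : Obj → Obj
    η   : ∀ {A} → Hom A (T A)
    _*  : ∀ {A B} → Hom A (T B) → Hom (T A) (T B)
    *-resp-≈ : ∀ {A B} {f g : Hom A (T B)} → f ≈ g → f * ≈ g *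
    η*       : ∀ {A} → (η {A}) * ≈ id
    *-η      : ∀ {A B} {f : Hom A (T B)} → f * ∘ η ≈ f
    *-assoc  : ∀ {A B C} {f : Hom A (T B)} {g : Hom B (T C)} →
               (g * ∘ f) * ≈ g * ∘ f *

  T₁ : ∀ {A B} → Hom A B → Hom (T A) (T B)
  T₁ f = (η ∘ f) *

  μ : ∀ {A} → Hom (T (T A)) (T A)
  μ = id *

module Setup {o ℓ e} (𝒞 : Category o ℓ e) (cp : BinaryCoproducts 𝒞)
             (𝕋 : KleisliTriple 𝒞) where
  open Category 𝒞
  open BinaryCoproducts cp
  open KleisliTriple 𝕋

  castHom : ∀ {A A′ B B′} → A ≡ A′ → B ≡ B′ → Hom A B → Hom A′ B′
  castHom refl refl f = f

  ∇ : ∀ {A} → Hom (A + A) A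
  ∇ = [ id , id ]

  _⊕_ : ∀ {A B C D} → Hom A B → Hom C D → Hom (A + C) (B + D)
  f ⊕ g = [ inl ∘ f , inr ∘ g ]

  _#_ : Obj → Obj → Obj
  X # Y = T (X + Y)

  _#₁_ : ∀ {X X′ Y Y′} → Hom X X′ → Hom Y Y′ → Hom (X # Y) (X′ # Y′)
  f #₁ g = T₁ (f ⊕ g)

  u : ∀ {X Y} → Hom X (X # Y)
  u = η ∘ inl

  m : ∀ {X Y} → Hom (T (X # Y + Y)) (X # Y)
  m = [ id , η ∘ inr ] *

  record EMAlg : Set (o ⊔ ℓ ⊔ e) where
    field
      A     : Obj
      α     : Hom (T A) A
      unit  : α ∘ η ≈ id
      mult  : α ∘ T₁ α ≈ α ∘ μ

  record EMHom (X Y : EMAlg) : Set (ℓ ⊔ e) where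
    private
      module X = EMAlg X
      module Y = EMAlg Y
    field
      map  : Hom X.A Y.A
      comm : map ∘ X.α ≈ Y.α ∘ T₁ map

  EMObjEq : EMAlg → EMAlg → Set (o ⊔ e)
  EMObjEq X Y = Σ (EMAlg.A X ≡ EMAlg.A Y) λ p →
                  castHom (cong T p) p (EMAlg.α X) ≈ EMAlg.α Y

  record HashAlg : Set (o ⊔ ℓ ⊔ e) where
    field
      A     : Obj
      a     : Hom (A # A) A
      unit  : a ∘ u ≈ id
      mult  : a ∘ (a #₁ id) ≈ a ∘ m
      factors : ∃ λ (a′ : Hom (T A) A) → a ≈ a′ ∘ T₁ ∇

  record HashHom (X Y : HashAlg) : Set (ℓ ⊔ e) where
    private
      module X = HashAlg X
      module Y = HashAlg Y
    field
      map  : Hom X.A Y.A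
      comm : map ∘ X.a ≈ Y.a ∘ (map #₁ map)

  -- equality of objects (the factorisation is a property, not data)
  HashObjEq : HashAlg → HashAlg → Set (o ⊔ e)
  HashObjEq X Y = Σ (HashAlg.A X ≡ HashAlg.A Y) λ p →
                    castHom (cong (λ B → B # B) p) p (HashAlg.a X) ≈ HashAlg.a Y

  module Aux where
    hom-setoid : ∀ {A B} → Setoid ℓ e
    hom-setoid {A} {B} = record { Carrier = Hom A B ; _≈_ = _≈_ ; isEquivalence = equiv }

    module _ {A B : Obj} where
      open IsEquivalence (equiv {A} {B}) public
        renaming (refl to ≈-refl; sym to ≈-sym; trans to ≈-trans)

    open Category 𝒞 using () renaming (_∘_ to _∘′_)

    T-id : ∀ {A} → T₁ (id {A}) ≈ id
    T-id = ≈-trans (*-resp-≈ identityʳ) η*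

    T-∘ : ∀ {A B C} {f : Hom A B} {g : Hom B C} → T₁ (g ∘ f) ≈ T₁ g ∘ T₁ f
    T-∘ {f = f} {g} = begin
        (η ∘ (g ∘ f)) *          ≈⟨ *-resp-≈ (≈-sym assoc) ⟩
        ((η ∘ g) ∘ f) *          ≈⟨ *-resp-≈ (∘-resp-≈ (≈-sym *-η) ≈-refl) ⟩
        (((η ∘ g) * ∘ η) ∘ f) *  ≈⟨ *-resp-≈ assoc ⟩
        ((η ∘ g) * ∘ (η ∘ f)) *  ≈⟨ *-assoc ⟩
        T₁ g ∘ T₁ f              ∎
      where open SetoidR hom-setoid

    []-cong : ∀ {A B C} {f f′ : Hom A C} {g g′ : Hom B C} →
              f ≈ f′ → g ≈ g′ → [ f , g ] ≈ [ f′ , g′ ]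
    []-cong p q = ≈-sym (unique (≈-trans inject₁ p) (≈-trans inject₂ q))

    ⊕-id : ∀ {A B} → (id {A}) ⊕ (id {B}) ≈ id
    ⊕-id = unique (≈-trans identityˡ (≈-sym identityʳ))
                  (≈-trans identityˡ (≈-sym identityʳ))

    ⊕-∘ : ∀ {A B C A′ B′ C′} {f : Hom A B} {g : Hom B C}
            {f′ : Hom A′ B′} {g′ : Hom B′ C′} →
          (g ∘ f) ⊕ (g′ ∘ f′) ≈ (g ⊕ g′) ∘ (f ⊕ f′)
    ⊕-∘ {A} {B} {C} {A′} {B′} {C′} {f = f} {g} {f′} {g′} = unique l r
      where
        l : ((g ⊕ g′) ∘ (f ⊕ f′)) ∘ inl ≈ inl ∘ (g ∘ f)
        l = begin
          ((g ⊕ g′) ∘ (f ⊕ f′)) ∘ inl ≈⟨ assoc ⟩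
          (g ⊕ g′) ∘ ((f ⊕ f′) ∘ inl) ≈⟨ ∘-resp-≈ ≈-refl inject₁ ⟩
          (g ⊕ g′) ∘ (inl ∘ f)        ≈⟨ ≈-sym assoc ⟩
          ((g ⊕ g′) ∘ inl) ∘ f        ≈⟨ ∘-resp-≈ inject₁ ≈-refl ⟩
          (inl ∘ g) ∘ f               ≈⟨ assoc ⟩
          inl ∘ (g ∘ f)               ∎
          where open SetoidR (hom-setoid {A} {C + C′})
        r : ((g ⊕ g′) ∘ (f ⊕ f′)) ∘ inr ≈ inr ∘ (g′ ∘ f′)
        r = begin
          ((g ⊕ g′) ∘ (f ⊕ f′)) ∘ inr ≈⟨ assoc ⟩
          (g ⊕ g′) ∘ ((f ⊕ f′) ∘ inr) ≈⟨ ∘-resp-≈ ≈-refl inject₂ ⟩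
          (g ⊕ g′) ∘ (inr ∘ f′)       ≈⟨ ≈-sym assoc ⟩
          ((g ⊕ g′) ∘ inr) ∘ f′       ≈⟨ ∘-resp-≈ inject₂ ≈-refl ⟩
          (inr ∘ g′) ∘ f′             ≈⟨ assoc ⟩
          inr ∘ (g′ ∘ f′)             ∎
          where open SetoidR (hom-setoid {A′} {C + C′})

    #-id : ∀ {A B} → (id {A}) #₁ (id {B}) ≈ id
    #-id = ≈-trans (*-resp-≈ (∘-resp-≈ ≈-refl ⊕-id)) T-id

    #-∘ : ∀ {A B C A′ B′ C′} {f : Hom A B} {g : Hom B C}
            {f′ : Hom A′ B′} {g′ : Hom B′ C′} →
          (g ∘ f) #₁ (g′ ∘ f′) ≈ (g #₁ g′) ∘ (f #₁ f′)
    #-∘ = ≈-trans (*-resp-≈ (∘-resp-≈ ≈-refl ⊕-∘)) T-∘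

    idSq : ∀ {X Y} (a : Hom X Y) (Fid : Hom X X) → Fid ≈ id → id ∘ a ≈ a ∘ Fid
    idSq a Fid p = ≈-trans identityˡ (≈-trans (≈-sym identityʳ) (∘-resp-≈ ≈-refl (≈-sym p)))

    compSq : ∀ {SX SY SZ X Y Z} (a : Hom SX X) (b : Hom SY Y) (c : Hom SZ Z)
               (f : Hom X Y) (g : Hom Y Z)
               (Ff : Hom SX SY) (Fg : Hom SY SZ) (Fgf : Hom SX SZ) →
             f ∘ a ≈ b ∘ Ff → g ∘ b ≈ c ∘ Fg → Fgf ≈ Fg ∘ Ff →
             (g ∘ f) ∘ a ≈ c ∘ Fgf
    compSq a b c f g Ff Fg Fgf p q r = begin
      (g ∘ f) ∘ a     ≈⟨ assoc ⟩
      g ∘ (f ∘ a)     ≈⟨ ∘-resp-≈ ≈-refl p ⟩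
      g ∘ (b ∘ Ff)    ≈⟨ ≈-sym assoc ⟩
      (g ∘ b) ∘ Ff    ≈⟨ ∘-resp-≈ q ≈-refl ⟩
      (c ∘ Fg) ∘ Ff   ≈⟨ assoc ⟩
      c ∘ (Fg ∘ Ff)   ≈⟨ ∘-resp-≈ ≈-refl (≈-sym r) ⟩
      c ∘ Fgf         ∎
      where open SetoidR hom-setoid

  open Aux using (T-id; T-∘; #-id; #-∘; idSq; compSq)

  EMCat : Category (o ⊔ ℓ ⊔ e) (ℓ ⊔ e) e
  EMCat = record
    { Obj = EMAlg
    ; Hom = EMHom
    ; _≈_ = λ f g → EMHom.map f ≈ EMHom.map g
    ; id  = λ {X} → record { map = id ; comm = idSq (EMAlg.α X) (T₁ id) T-id }
    ; _∘_ = λ {X} {Y} {Z} g f → record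
        { map = EMHom.map g ∘ EMHom.map f
        ; comm = compSq (EMAlg.α X) (EMAlg.α Y) (EMAlg.α Z) (EMHom.map f) (EMHom.map g)
                        (T₁ (EMHom.map f)) (T₁ (EMHom.map g)) _
                        (EMHom.comm f) (EMHom.comm g) T-∘ }
    ; equiv = record { refl = IsEquivalence.refl equiv
                     ; sym = IsEquivalence.sym equiv
                     ; trans = IsEquivalence.trans equiv }
    ; ∘-resp-≈ = ∘-resp-≈
    ; identityˡ = identityˡ
    ; identityʳ = identityʳ
    ; assoc = assoc
    }

  HashFCat : Category (o ⊔ ℓ ⊔ e) (ℓ ⊔ e) e
  HashFCat = record
    { Obj = HashAlg
    ; Hom = HashHom
    ; _≈_ = λ f g → HashHom.map f ≈ HashHom.map g
    ; id  = λ {X} → record { map = id ; comm = idSq (HashAlg.a X) (id #₁ id) #-id }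
    ; _∘_ = λ {X} {Y} {Z} g f → record
        { map = HashHom.map g ∘ HashHom.map f
        ; comm = compSq (HashAlg.a X) (HashAlg.a Y) (HashAlg.a Z) (HashHom.map f) (HashHom.map g)
                        (HashHom.map f #₁ HashHom.map f) (HashHom.map g #₁ HashHom.map g) _
                        (HashHom.comm f) (HashHom.comm g) #-∘ }
    ; equiv = record { refl = IsEquivalence.refl equiv
                     ; sym = IsEquivalence.sym equiv
                     ; trans = IsEquivalence.trans equiv }
    ; ∘-resp-≈ = ∘-resp-≈
    ; identityˡ = identityˡ
    ; identityʳ = identityʳ
    ; assoc = assoc
    }

  -- isomorphism of categories C^T ≅ HashFCat:
  -- functors F, G with G ∘ F = Id and F ∘ G = Id, where equality of
  -- objects is equality of carrier and structure map, and equality of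
  -- morphisms is equality (≈) of underlying maps, transported along
  -- the object equalities.

  record EM≅HashF : Set (o ⊔ ℓ ⊔ e) where
    field
      F : Functor EMCat HashFCat
      G : Functor HashFCat EMCat
    open Functor F using () renaming (F₀ to F₀; F₁ to F₁)
    open Functor G using () renaming (F₀ to G₀; F₁ to G₁)
    field
      GF₀ : ∀ X → EMObjEq (G₀ (F₀ X)) X
      FG₀ : ∀ Y → HashObjEq (F₀ (G₀ Y)) Y
      GF₁ : ∀ {X Y} (f : EMHom X Y) →
            castHom (proj₁ (GF₀ X)) (proj₁ (GF₀ Y)) (EMHom.map (G₁ (F₁ f)))
              ≈ EMHom.map f
      FG₁ : ∀ {X Y} (f : HashHom X Y) →
            castHom (proj₁ (FG₀ X)) (proj₁ (FG₀ Y)) (HashHom.map (F₁ (G₁ f)))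
              ≈ HashHom.map f

C^T≅Hash∇ : ∀ {o ℓ e} (𝒞 : Category o ℓ e) → BinaryCoproducts 𝒞 →
            KleisliTriple 𝒞 → Set (o ⊔ ℓ ⊔ e)
C^T≅Hash∇ 𝒞 cp 𝕋 = Setup.EM≅HashF 𝒞 cp 𝕋

-- A #-algebra a factoring through T∇ determines its factor: a ≈ a′ ∘ T∇ forces
-- a′ ≈ a ∘ T inl, because ∇ ∘ inl = id. So α ↦ α ∘ T∇ and a ↦ a ∘ T inl are
-- mutually inverse on structure maps, and both functors act as the identity on
-- underlying morphisms. The Eilenberg–Moore laws give the #-algebra laws through
-- α ∘ g* ≈ α ∘ T(α ∘ g); conversely, precomposing the #-associativity law with
-- T(inl ∘ T inl) yields the Eilenberg–Moore associativity law.
module Submission where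

open import Defs
open import Data.Product using (_,_; proj₁; proj₂)
open import Relation.Binary.PropositionalEquality using (refl)
import Relation.Binary.Reasoning.Setoid as SetoidR

module EM≅Hash∇ {o ℓ e} (𝒞 : Category o ℓ e) (cp : BinaryCoproducts 𝒞)
                (𝕋 : KleisliTriple 𝒞) where
  open Category 𝒞
  open BinaryCoproducts cp
  open KleisliTriple 𝕋
  open Setup 𝒞 cp 𝕋
  open Aux using (hom-setoid; ≈-refl; ≈-sym; ≈-trans; T-∘)

  infixr 4 refl⟩∘⟨_
  infixl 5 _⟩∘⟨refl

  refl⟩∘⟨_ : ∀ {A B C} {f : Hom B C} {g h : Hom A B} → g ≈ h → f ∘ g ≈ f ∘ h
  refl⟩∘⟨ p = ∘-resp-≈ ≈-refl p

  _⟩∘⟨refl : ∀ {A B C} {f g : Hom B C} {h : Hom A B} → f ≈ g → f ∘ h ≈ g ∘ h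
  p ⟩∘⟨refl = ∘-resp-≈ p ≈-refl

  T₁-resp-≈ : ∀ {A B} {f g : Hom A B} → f ≈ g → T₁ f ≈ T₁ g
  T₁-resp-≈ p = *-resp-≈ (refl⟩∘⟨ p)

  *∘T₁ : ∀ {A B C} {f : Hom B (T C)} {h : Hom A B} → f * ∘ T₁ h ≈ (f ∘ h) *
  *∘T₁ {f = f} {h} = begin
    f * ∘ (η ∘ h) *     ≈⟨ *-assoc ⟨
    (f * ∘ (η ∘ h)) *   ≈⟨ *-resp-≈ (≈-sym assoc) ⟩
    ((f * ∘ η) ∘ h) *   ≈⟨ *-resp-≈ (*-η ⟩∘⟨refl) ⟩
    (f ∘ h) *           ∎
    where open SetoidR hom-setoid

  μ∘T₁ : ∀ {A B} {f : Hom A (T B)} → μ ∘ T₁ f ≈ f *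
  μ∘T₁ = ≈-trans *∘T₁ (*-resp-≈ identityˡ)

  ∘-[] : ∀ {A B C D} {f : Hom A C} {g : Hom B C} {h : Hom C D} →
         h ∘ [ f , g ] ≈ [ h ∘ f , h ∘ g ]
  ∘-[] = ≈-sym (unique (≈-trans assoc (refl⟩∘⟨ inject₁))
                       (≈-trans assoc (refl⟩∘⟨ inject₂)))

  []∘⊕ : ∀ {A B C D E} {f : Hom C E} {g : Hom D E} {h : Hom A C} {k : Hom B D} →
         [ f , g ] ∘ (h ⊕ k) ≈ [ f ∘ h , g ∘ k ]
  []∘⊕ {f = f} {g} {h} {k} = begin
    [ f , g ] ∘ [ inl ∘ h , inr ∘ k ]                      ≈⟨ ∘-[] ⟩
    [ [ f , g ] ∘ (inl ∘ h) , [ f , g ] ∘ (inr ∘ k) ]      ≈⟨ Aux.[]-cong (≈-sym assoc) (≈-sym assoc) ⟩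
    [ ([ f , g ] ∘ inl) ∘ h , ([ f , g ] ∘ inr) ∘ k ]      ≈⟨ Aux.[]-cong (inject₁ ⟩∘⟨refl) (inject₂ ⟩∘⟨refl) ⟩
    [ f ∘ h , g ∘ k ]                                      ∎
    where open SetoidR hom-setoid

  ∇∘⊕ : ∀ {A B C} {f : Hom A C} {g : Hom B C} → ∇ ∘ (f ⊕ g) ≈ [ f , g ]
  ∇∘⊕ = ≈-trans []∘⊕ (Aux.[]-cong identityˡ identityˡ)

  ∇-natural : ∀ {A B} {f : Hom A B} → f ∘ ∇ ≈ ∇ ∘ (f ⊕ f)
  ∇-natural = ≈-trans ∘-[] (≈-trans (Aux.[]-cong identityʳ identityʳ) (≈-sym ∇∘⊕))

  T₁∇-natural : ∀ {A B} {f : Hom A B} → T₁ f ∘ T₁ ∇ ≈ T₁ ∇ ∘ (f #₁ f)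
  T₁∇-natural = ≈-trans (≈-sym T-∘) (≈-trans (T₁-resp-≈ ∇-natural) T-∘)

  T₁∇∘T₁inl : ∀ {A} → T₁ (∇ {A}) ∘ T₁ inl ≈ id
  T₁∇∘T₁inl = ≈-trans (≈-sym T-∘) (≈-trans (T₁-resp-≈ inject₁) Aux.T-id)

  #₁∘T₁inl : ∀ {A B} {f : Hom A B} → (f #₁ f) ∘ T₁ inl ≈ T₁ inl ∘ T₁ f
  #₁∘T₁inl = ≈-trans (≈-sym T-∘) (≈-trans (T₁-resp-≈ inject₁) T-∘)

  factor-unique : ∀ {A} {a : Hom (A # A) A} {a′ : Hom (T A) A} →
                  a ≈ a′ ∘ T₁ ∇ → a′ ≈ a ∘ T₁ inl
  factor-unique {a = a} {a′} a≈a′∘T∇ = begin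
    a′                    ≈⟨ identityʳ ⟨
    a′ ∘ id               ≈⟨ refl⟩∘⟨ T₁∇∘T₁inl ⟨
    a′ ∘ (T₁ ∇ ∘ T₁ inl)  ≈⟨ assoc ⟨
    (a′ ∘ T₁ ∇) ∘ T₁ inl  ≈⟨ a≈a′∘T∇ ⟩∘⟨refl ⟨
    a ∘ T₁ inl            ∎
    where open SetoidR hom-setoid

  module _ (X : EMAlg) where
    open EMAlg X

    algebra-∘-* : ∀ {Z} {g : Hom Z (T A)} → α ∘ g * ≈ α ∘ T₁ (α ∘ g)
    algebra-∘-* {g = g} = begin
      α ∘ g *              ≈⟨ refl⟩∘⟨ μ∘T₁ ⟨
      α ∘ (μ ∘ T₁ g)       ≈⟨ assoc ⟨
      (α ∘ μ) ∘ T₁ g       ≈⟨ mult ⟩∘⟨refl ⟨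
      (α ∘ T₁ α) ∘ T₁ g    ≈⟨ assoc ⟩
      α ∘ (T₁ α ∘ T₁ g)    ≈⟨ refl⟩∘⟨ T-∘ ⟨
      α ∘ T₁ (α ∘ g)       ∎
      where open SetoidR hom-setoid

    ∘T₁∇-η-section : {ι : Hom A (A + A)} → ∇ ∘ ι ≈ id → (α ∘ T₁ ∇) ∘ (η ∘ ι) ≈ id
    ∘T₁∇-η-section {ι} ∇∘ι≈id = begin
      (α ∘ T₁ ∇) ∘ (η ∘ ι)   ≈⟨ assoc ⟩
      α ∘ (T₁ ∇ ∘ (η ∘ ι))   ≈⟨ refl⟩∘⟨ assoc ⟨
      α ∘ ((T₁ ∇ ∘ η) ∘ ι)   ≈⟨ refl⟩∘⟨ *-η ⟩∘⟨refl ⟩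
      α ∘ ((η ∘ ∇) ∘ ι)      ≈⟨ refl⟩∘⟨ assoc ⟩
      α ∘ (η ∘ (∇ ∘ ι))      ≈⟨ refl⟩∘⟨ refl⟩∘⟨ ∇∘ι≈id ⟩
      α ∘ (η ∘ id)           ≈⟨ refl⟩∘⟨ identityʳ ⟩
      α ∘ η                  ≈⟨ unit ⟩
      id                     ∎
      where open SetoidR hom-setoid

    ∘T₁∇∘m-components : (α ∘ T₁ ∇) ∘ [ id , η ∘ inr ] ≈ [ α ∘ T₁ ∇ , id ]
    ∘T₁∇∘m-components =
      ≈-trans ∘-[] (Aux.[]-cong identityʳ (∘T₁∇-η-section inject₂))

    ∘T₁∇-assoc : (α ∘ T₁ ∇) ∘ ((α ∘ T₁ ∇) #₁ id) ≈ (α ∘ T₁ ∇) ∘ m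
    ∘T₁∇-assoc = begin
      (α ∘ T₁ ∇) ∘ T₁ ((α ∘ T₁ ∇) ⊕ id)        ≈⟨ assoc ⟩
      α ∘ (T₁ ∇ ∘ T₁ ((α ∘ T₁ ∇) ⊕ id))        ≈⟨ refl⟩∘⟨ T-∘ ⟨
      α ∘ T₁ (∇ ∘ ((α ∘ T₁ ∇) ⊕ id))           ≈⟨ refl⟩∘⟨ T₁-resp-≈ ∇∘⊕ ⟩
      α ∘ T₁ [ α ∘ T₁ ∇ , id ]                 ≈⟨ refl⟩∘⟨ T₁-resp-≈ ∘T₁∇∘m-components ⟨
      α ∘ T₁ ((α ∘ T₁ ∇) ∘ [ id , η ∘ inr ])   ≈⟨ refl⟩∘⟨ T₁-resp-≈ assoc ⟩
      α ∘ T₁ (α ∘ (T₁ ∇ ∘ [ id , η ∘ inr ]))   ≈⟨ algebra-∘-* ⟨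
      α ∘ (T₁ ∇ ∘ [ id , η ∘ inr ]) *          ≈⟨ refl⟩∘⟨ *-assoc ⟩
      α ∘ (T₁ ∇ ∘ m)                           ≈⟨ assoc ⟨
      (α ∘ T₁ ∇) ∘ m                           ∎
      where open SetoidR hom-setoid

  F₀ : EMAlg → HashAlg
  F₀ X = record
    { A       = A
    ; a       = α ∘ T₁ ∇
    ; unit    = ∘T₁∇-η-section X inject₁
    ; mult    = ∘T₁∇-assoc X
    ; factors = α , ≈-refl
    }
    where open EMAlg X

  F₁ : ∀ {X Y} → EMHom X Y → HashHom (F₀ X) (F₀ Y)
  F₁ {X} {Y} f = record { map = map ; comm = comm′ }
    where
      open EMHom f
      module X = EMAlg X
      module Y = EMAlg Y
      comm′ : map ∘ (X.α ∘ T₁ ∇) ≈ (Y.α ∘ T₁ ∇) ∘ (map #₁ map)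
      comm′ = begin
        map ∘ (X.α ∘ T₁ ∇)              ≈⟨ assoc ⟨
        (map ∘ X.α) ∘ T₁ ∇              ≈⟨ comm ⟩∘⟨refl ⟩
        (Y.α ∘ T₁ map) ∘ T₁ ∇           ≈⟨ assoc ⟩
        Y.α ∘ (T₁ map ∘ T₁ ∇)           ≈⟨ refl⟩∘⟨ T₁∇-natural ⟩
        Y.α ∘ (T₁ ∇ ∘ (map #₁ map))     ≈⟨ assoc ⟨
        (Y.α ∘ T₁ ∇) ∘ (map #₁ map)     ∎
        where open SetoidR hom-setoid

  #₁id∘T₁[inl∘T₁inl] : ∀ {X Y Z} {f : Hom (T (X + Y)) Z} →
                        (f #₁ id {Y}) ∘ T₁ (inl ∘ T₁ inl) ≈ T₁ inl ∘ T₁ (f ∘ T₁ inl)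
  #₁id∘T₁[inl∘T₁inl] {f = f} = begin
    T₁ (f ⊕ id) ∘ T₁ (inl ∘ T₁ inl)   ≈⟨ T-∘ ⟨
    T₁ ((f ⊕ id) ∘ (inl ∘ T₁ inl))    ≈⟨ T₁-resp-≈ (≈-sym assoc) ⟩
    T₁ (((f ⊕ id) ∘ inl) ∘ T₁ inl)    ≈⟨ T₁-resp-≈ (inject₁ ⟩∘⟨refl) ⟩
    T₁ ((inl ∘ f) ∘ T₁ inl)           ≈⟨ T₁-resp-≈ assoc ⟩
    T₁ (inl ∘ (f ∘ T₁ inl))           ≈⟨ T-∘ ⟩
    T₁ inl ∘ T₁ (f ∘ T₁ inl)          ∎
    where open SetoidR hom-setoid

  m∘T₁[inl∘T₁inl] : ∀ {X Y} → m ∘ T₁ (inl ∘ T₁ inl) ≈ (T₁ (inl {X} {Y})) *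
  m∘T₁[inl∘T₁inl] = begin
    m ∘ T₁ (inl ∘ T₁ inl)                   ≈⟨ *∘T₁ ⟩
    ([ id , η ∘ inr ] ∘ (inl ∘ T₁ inl)) *   ≈⟨ *-resp-≈ (≈-sym assoc) ⟩
    (([ id , η ∘ inr ] ∘ inl) ∘ T₁ inl) *   ≈⟨ *-resp-≈ (inject₁ ⟩∘⟨refl) ⟩
    (id ∘ T₁ inl) *                         ≈⟨ *-resp-≈ identityˡ ⟩
    (T₁ inl) *                              ∎
    where open SetoidR hom-setoid

  module _ (Y : HashAlg) where
    open HashAlg Y
    private
      a′ : Hom (T A) A
      a′ = proj₁ factors

      a′≈a∘T₁inl : a′ ≈ a ∘ T₁ inl
      a′≈a∘T₁inl = factor-unique (proj₂ factors)

    factor-unit : a′ ∘ η ≈ id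
    factor-unit = begin
      a′ ∘ η               ≈⟨ a′≈a∘T₁inl ⟩∘⟨refl ⟩
      (a ∘ T₁ inl) ∘ η     ≈⟨ assoc ⟩
      a ∘ (T₁ inl ∘ η)     ≈⟨ refl⟩∘⟨ *-η ⟩
      a ∘ (η ∘ inl)        ≈⟨ unit ⟩
      id                   ∎
      where open SetoidR hom-setoid

    factor-assoc : a′ ∘ T₁ a′ ≈ a′ ∘ μ
    factor-assoc = begin
      a′ ∘ T₁ a′                      ≈⟨ a′≈a∘T₁inl ⟩∘⟨refl ⟩
      (a ∘ T₁ inl) ∘ T₁ a′            ≈⟨ assoc ⟩
      a ∘ (T₁ inl ∘ T₁ a′)            ≈⟨ refl⟩∘⟨ T₁inl∘T₁a′ ⟨
      a ∘ ((a #₁ id) ∘ j)             ≈⟨ assoc ⟨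
      (a ∘ (a #₁ id)) ∘ j             ≈⟨ mult ⟩∘⟨refl ⟩
      (a ∘ m) ∘ j                     ≈⟨ assoc ⟩
      a ∘ (m ∘ j)                     ≈⟨ refl⟩∘⟨ m∘T₁[inl∘T₁inl] ⟩
      a ∘ (T₁ inl) *                  ≈⟨ proj₂ factors ⟩∘⟨refl ⟩
      (a′ ∘ T₁ ∇) ∘ (T₁ inl) *        ≈⟨ assoc ⟩
      a′ ∘ (T₁ ∇ ∘ (T₁ inl) *)        ≈⟨ refl⟩∘⟨ *-assoc ⟨
      a′ ∘ (T₁ ∇ ∘ T₁ inl) *          ≈⟨ refl⟩∘⟨ *-resp-≈ T₁∇∘T₁inl ⟩
      a′ ∘ μ                          ∎
      where
        open SetoidR hom-setoid
        j : Hom (T (T A)) (T (A # A + A))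
        j = T₁ (inl ∘ T₁ inl)
        T₁inl∘T₁a′ : (a #₁ id) ∘ j ≈ T₁ inl ∘ T₁ a′
        T₁inl∘T₁a′ = ≈-trans #₁id∘T₁[inl∘T₁inl] (refl⟩∘⟨ T₁-resp-≈ (≈-sym a′≈a∘T₁inl))

  G₀ : HashAlg → EMAlg
  G₀ Y = record
    { A    = HashAlg.A Y
    ; α    = proj₁ (HashAlg.factors Y)
    ; unit = factor-unit Y
    ; mult = factor-assoc Y
    }

  G₁ : ∀ {X Y} → HashHom X Y → EMHom (G₀ X) (G₀ Y)
  G₁ {X} {Y} f = record { map = map ; comm = comm′ }
    where
      open HashHom f
      module X = HashAlg X
      module Y = HashAlg Y
      comm′ : map ∘ proj₁ X.factors ≈ proj₁ Y.factors ∘ T₁ map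
      comm′ = begin
        map ∘ proj₁ X.factors             ≈⟨ refl⟩∘⟨ factor-unique (proj₂ X.factors) ⟩
        map ∘ (X.a ∘ T₁ inl)              ≈⟨ assoc ⟨
        (map ∘ X.a) ∘ T₁ inl              ≈⟨ comm ⟩∘⟨refl ⟩
        (Y.a ∘ (map #₁ map)) ∘ T₁ inl     ≈⟨ assoc ⟩
        Y.a ∘ ((map #₁ map) ∘ T₁ inl)     ≈⟨ refl⟩∘⟨ #₁∘T₁inl ⟩
        Y.a ∘ (T₁ inl ∘ T₁ map)           ≈⟨ assoc ⟨
        (Y.a ∘ T₁ inl) ∘ T₁ map           ≈⟨ factor-unique (proj₂ Y.factors) ⟩∘⟨refl ⟨
        proj₁ Y.factors ∘ T₁ map          ∎
        where open SetoidR hom-setoid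

  iso : EM≅HashF
  iso = record
    { F   = record { F₀ = F₀ ; F₁ = F₁ ; identity = ≈-refl ; homomorphism = ≈-refl ; F-resp-≈ = λ p → p }
    ; G   = record { F₀ = G₀ ; F₁ = G₁ ; identity = ≈-refl ; homomorphism = ≈-refl ; F-resp-≈ = λ p → p }
    ; GF₀ = λ X → refl , ≈-refl
    ; FG₀ = λ Y → refl , ≈-sym (proj₂ (HashAlg.factors Y))
    ; GF₁ = λ f → ≈-refl
    ; FG₁ = λ f → ≈-refl
    }

corollary4p7 : ∀ {o ℓ e} (𝒞 : Category o ℓ e) (init : Initial 𝒞)
    (cp : BinaryCoproducts 𝒞) (𝕋 : KleisliTriple 𝒞) →
    C^T≅Hash∇ 𝒞 cp 𝕋
corollary4p7 𝒞 _ cp 𝕋 = EM≅Hash∇.iso 𝒞 cp 𝕋
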